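{- Let $V$ be a finite set of boxes and let $w,w':V\to[0,1]^d$ be two size functions (instances of the orthogonal packing problem in the unit cube $[0,1]^d$). Suppose that for all $i\in\{1,\dots,d\}$, $$\mathcal F(V,w_i)\subseteq \mathcal F(V,w'_i).$$ Then every packing class for $(V,w)$ is also a packing class for $(V,w')$.
   Context: A box $b\in V$ has size $w(b)=(w_1(b),\dots,w_d(b))$, with $w_i(b)$ its extent in coordinate direction $i$; the container is the unit cube. For a size function $w$ and $i\in\{1,\dots,d\}$, the family of $i$-feasible box sets is $\mathcal F(V,w_i)=\{S\subseteq V : \sum_{b\in S} w_i(b)\le 1\}$. A packing class for $(V,w)$ is a $d$-tuple of graphs $G_i=(V,E_i)$, $i=1,\dots,d$, such that (P1) each $G_i$ is an interval graph; (P2) every stable set of $G_i$ belongs to $\mathcal F(V,w_i)$; (P3) $\bigcap_{i=1}^d E_i=\emptyset$. -}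

module Defs where

open import Data.Nat using (ℕ; zero; suc)
import Data.Nat as ℕ
open import Data.Bool using (Bool; true; false; if_then_else_)
open import Data.Fin using (Fin)
open import Data.Fin.Subset using (Subset; _∈_)
open import Data.Vec using (Vec; []; _∷_)
open import Data.Product using (Σ; _×_; ∃; ∃-syntax)
open import Data.Empty using (⊥)
open import Relation.Nullary using (¬_)
open import Relation.Binary.PropositionalEquality using (_≢_)
open import Function.Bundles using (_⇔_)

-- The paper uses the reals; Agda's
-- standard library has no reals, so we quantify over an arbitrary carrier
-- with 0, 1, addition and an order (the reals are one instance).
record Scalars : Set₁ where
  field
    Carrier : Set
    0#      : Carrier
    1#      : Carrier
    _+_     : Carrier → Carrier → Carrier
    _≤_     : Carrier → Carrier → Set

module _ (K : Scalars) where
  open Scalars K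

  sumOver : ∀ {n} → Subset n → (Fin n → Carrier) → Carrier
  sumOver []            f = 0#
  sumOver (true  ∷ S) f = f Fin.zero + sumOver S (λ v → f (Fin.suc v))
  sumOver (false ∷ S) f = sumOver S (λ v → f (Fin.suc v))

  SizeFunction : ℕ → ℕ → Set
  SizeFunction n d = Fin n → Fin d → Carrier

  IsUnitSized : ∀ {n d} → SizeFunction n d → Set
  IsUnitSized {n} {d} w = ∀ (b : Fin n) (i : Fin d) → (0# ≤ w b i) × (w b i ≤ 1#)

  Feasible : ∀ {n d} → SizeFunction n d → Fin d → Subset n → Set
  Feasible w i S = sumOver S (λ b → w b i) ≤ 1#

Graph : ℕ → Set₁
Graph n = Fin n → Fin n → Set

-- Interval graph: there are closed intervals [l v, r v] (endpoints in ℕ,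
-- which is no loss of generality for finite graphs) such that
-- u v adjacent  ⇔  u ≠ v and the intervals of u and v intersect.
IsIntervalGraph : ∀ {n} → Graph n → Set
IsIntervalGraph {n} E =
  Σ (Fin n → ℕ) λ l → Σ (Fin n → ℕ) λ r →
    (∀ v → l v ℕ.≤ r v) ×
    (∀ u v → E u v ⇔ (u ≢ v × l u ℕ.≤ r v × l v ℕ.≤ r u))

IsStable : ∀ {n} → Graph n → Subset n → Set
IsStable E S = ∀ u v → u ∈ S → v ∈ S → ¬ E u v

record IsPackingClass (K : Scalars) {n d : ℕ} (w : SizeFunction K n d)
                      (G : Fin d → Graph n) : Set where
  field
    P1 : ∀ i → IsIntervalGraph (G i)
    P2 : ∀ i S → IsStable (G i) S → Feasible K w i S
    P3 : ¬ (∃[ u ] ∃[ v ] (∀ i → G i u v))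

{-# OPTIONS --safe #-}
module Submission where

open import Defs
open import Data.Nat using (ℕ)
open import Data.Fin using (Fin)
open import Data.Fin.Subset using (Subset)

IsPackingClass-mono : ∀ {K n d} {w w′ : SizeFunction K n d} →
  (∀ i S → Feasible K w i S → Feasible K w′ i S) →
  ∀ {G} → IsPackingClass K w G → IsPackingClass K w′ G
IsPackingClass-mono 𝓕w⊆𝓕w′ pc = record
  { P1 = P1
  ; P2 = λ i S stable → 𝓕w⊆𝓕w′ i S (P2 i S stable)
  ; P3 = P3
  }
  where open IsPackingClass pc

theorem6 : (K : Scalars) (n d : ℕ) (w w′ : SizeFunction K n d) →
    IsUnitSized K w → IsUnitSized K w′ →
    (∀ (i : Fin d) (S : Subset n) → Feasible K w i S → Feasible K w′ i S) →
    ∀ (G : Fin d → Graph n) → IsPackingClass K w G → IsPackingClass K w′ G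
theorem6 _ _ _ _ _ _ _ 𝓕w⊆𝓕w′ _ = IsPackingClass-mono 𝓕w⊆𝓕w′
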